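{- Fix an initial parameter $\gamma_0>1$ and a bucket limit $m\ge1$. Let $\mathcal{D}_1$ and $\mathcal{D}_2$ be finite multisets of positive reals, and let $\mathcal{S}_1$, $\mathcal{S}_2$ be the sketches produced by UDDSketch (initial parameter $\gamma_0$, bucket limit $m$) processing $\mathcal{D}_1$ and $\mathcal{D}_2$ respectively as insertion-only streams. Let $\mathcal{S}_m$ be the sketch obtained by applying the UDDSketch merge procedure to $\mathcal{S}_1$ and $\mathcal{S}_2$, and let $\mathcal{S}_g$ be the sketch produced by UDDSketch (same $\gamma_0$, same $m$) processing the multiset sum $\mathcal{D}=\mathcal{D}_1\uplus\mathcal{D}_2$ as an insertion-only stream. Then $\mathcal{S}_g=\mathcal{S}_m$.
   Context: Multisets: a multiset is a pair $(N,f)$ with $N$ a set and $f:N\to\mathbb{N}$ the multiplicity function; the sum $(A,f)\uplus(B,g)$ is the multiset with underlying set $A\cup B$ and multiplicity $f+g$ (multiplicities extended by $0$ outside the underlying set). UDDSketch. A sketch consists of a parameter $\gamma>1$ and a finite collection of buckets $B_i$, $i\in\mathbb{Z}$, each an integer counter; only buckets with nonzero counter are kept, and the size of the sketch is the number of kept buckets. An item $x>0$ belongs to bucket $i=\lceil \log_\gamma x\rceil$. Initially the sketch is empty and $\gamma=\gamma_0$. Inserting $x$ increments $B_{\lceil\log_\gamma x\rceil}$ by one (creating it if absent). Uniform collapse: every bucket $B_i$ contributes its count to a new bucket with key $\lceil i/2\rceil$, and $\gamma$ is replaced by $\gamma^2$. Whenever the size exceeds $m$, uniform collapses are performed until the size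 is at most $m$. Merge procedure for two sketches with the same initial $\gamma_0$ and limit $m$: the sketch with the smaller current $\gamma$ is uniformly collapsed repeatedly until both have the same $\gamma$ (possible since both $\gamma$'s lie in $\{\gamma_0^{2^k}:k\ge0\}$); then a sketch with this $\gamma$ is formed whose bucket $i$ has counter $B^1_i+B^2_i$ for every key $i$ present in either sketch (absent buckets counting as $0$); finally, if its size exceeds $m$, uniform collapses are applied until the size is at most $m$. Two sketches are equal if they have the same $\gamma$ and the same buckets with the same counters. -}

module Defs where

open import Data.Nat as ℕ using (ℕ; zero; suc; _≤_; _<_; _∸_; _⊔_; ⌈_/2⌉; ⌊_/2⌋)
open import Data.Integer as ℤ using (ℤ; +_; -[1+_]; -_)
open import Data.Product using (_×_; _,_)
open import Data.List using (List; []; _∷_; length; foldr)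
open import Relation.Nullary using (yes; no)
open import Relation.Binary.PropositionalEquality using (_≡_)

ceilHalf : ℤ → ℤ
ceilHalf (+ n)    = + ⌈ n /2⌉
ceilHalf -[1+ n ] = - (+ ⌊ suc n /2⌋)

-- The current parameter γ = γ₀^(2^level) is represented by `level`.
-- Buckets: association list (key , counter); keys are pairwise distinct and
-- counters nonzero by construction, so the size is the length of the list.
record Sketch : Set where
  constructor sketch
  field
    level   : ℕ
    buckets : List (ℤ × ℕ)
open Sketch public

emptySketch : Sketch
emptySketch = sketch 0 []

size : Sketch → ℕ
size S = length (buckets S)

addTo : ℤ → ℕ → List (ℤ × ℕ) → List (ℤ × ℕ)
addTo i c [] = (i , c) ∷ []
addTo i c ((j , d) ∷ bs) with i ℤ.≟ j
... | yes _ = (j , d ℕ.+ c) ∷ bs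
... | no  _ = (j , d) ∷ addTo i c bs

count : Sketch → ℤ → ℕ
count S i = go (buckets S)
  where
  go : List (ℤ × ℕ) → ℕ
  go [] = 0
  go ((j , d) ∷ bs) with i ℤ.≟ j
  ... | yes _ = d ℕ.+ go bs
  ... | no  _ = go bs

collapse : Sketch → Sketch
collapse S = sketch (suc (level S))
  (foldr (λ { (i , c) acc → addTo (ceilHalf i) c acc }) [] (buckets S))

collapseN : ℕ → Sketch → Sketch
collapseN zero    S = S
collapseN (suc n) S = collapseN n (collapse S)

-- "Whenever the size exceeds m, collapse until the size is at most m"
-- (big-step relation: S ⇝ S' ; no result if the loop never ends).
data Normalize (m : ℕ) : Sketch → Sketch → Set where
  done : ∀ {S} → size S ≤ m → Normalize m S S
  step : ∀ {S S'} → m < size S → Normalize m (collapse S) S' → Normalize m S S'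

module _ {X : Set} (key : ℕ → X → ℤ) where
  -- key k x = ⌈ log_γ x ⌉ for γ = γ₀^(2^k)

  insertRaw : X → Sketch → Sketch
  insertRaw x S = sketch (level S) (addTo (key (level S) x) 1 (buckets S))

  data Process (m : ℕ) : Sketch → List X → Sketch → Set where
    pnil  : ∀ {S} → Process m S [] S
    pcons : ∀ {S S' S'' x xs} → Normalize m (insertRaw x S) S' →
            Process m S' xs S'' → Process m S (x ∷ xs) S''

  Produced : ℕ → List X → Sketch → Set
  Produced m xs S = Process m emptySketch xs S

combine : Sketch → Sketch → Sketch
combine S₁ S₂ = sketch k (foldr (λ { (i , c) acc → addTo i c acc }) (buckets T₁) (buckets T₂))
  where
  k  = level S₁ ⊔ level S₂
  T₁ = collapseN (k ∸ level S₁) S₁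
  T₂ = collapseN (k ∸ level S₂) S₂

Merge : ℕ → Sketch → Sketch → Sketch → Set
Merge m S₁ S₂ S = Normalize m (combine S₁ S₂) S

SketchEq : Sketch → Sketch → Set
SketchEq S T = (level S ≡ level T) × (∀ i → count S i ≡ count T i)

{-# OPTIONS --safe #-}
-- Every sketch UDDSketch produces from a multiset D is canonical: its level is
-- the least ℓ whose histogram of D (keys computed with γ₀^(2^ℓ)) has at most m
-- nonempty buckets, and its buckets are that histogram.  Collapsing commutes
-- with taking histograms (key (suc k) = ⌈key k / 2⌉), and adding items never
-- decreases the number of nonempty buckets, so a level that overflows for part
-- of the data overflows for all of it; hence insertion and merging both
-- preserve canonicity.  The canonical sketch depends on D alone, so the merged
-- sketch equals the one built from D₁ ⊎ D₂ directly.
module Submission where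

open import Defs
open import Data.Nat using (ℕ; zero; suc; _+_; _≤_; _<_; _⊔_; _∸_; z≤n; s≤s)
open import Data.Nat.Properties
open import Algebra.Properties.CommutativeSemigroup +-commutativeSemigroup using (x∙yz≈y∙xz)
open import Data.Integer using (ℤ)
import Data.Integer as ℤ
open import Data.List using (List; []; _∷_; _++_; length; foldr)
open import Data.List.Relation.Unary.All using (All; []; _∷_)
open import Data.List.Relation.Binary.Permutation.Propositional
  using (_↭_; refl; prep; swap; trans)
import Data.List.Relation.Binary.Permutation.Propositional.Properties as ↭
open import Data.Product using (_×_; _,_; proj₁)
open import Data.Sum using (inj₁; inj₂)
open import Data.Empty using (⊥-elim)
open import Function using (id; _∘_)
open import Relation.Nullary using (yes; no; ¬_)
open import Relation.Binary.PropositionalEquality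
  using (_≡_; _≢_; refl; sym; cong; cong₂; subst; module ≡-Reasoning)
  renaming (trans to ≡-trans)

Buckets : Set
Buckets = List (ℤ × ℕ)

point : ℤ → ℕ → ℤ → ℕ
point i c j with j ℤ.≟ i
... | yes _ = c
... | no  _ = 0

point-≡ : ∀ {i j} c → j ≡ i → point i c j ≡ c
point-≡ {i} {j} c j≡i with j ℤ.≟ i
... | yes _   = refl
... | no  j≢i = ⊥-elim (j≢i j≡i)

point-≢ : ∀ {i j} c → j ≢ i → point i c j ≡ 0
point-≢ {i} {j} c j≢i with j ℤ.≟ i
... | yes j≡i = ⊥-elim (j≢i j≡i)
... | no  _   = refl

point-+ : ∀ i c d j → point i (c + d) j ≡ point i c j + point i d j
point-+ i c d j with j ℤ.≟ i
... | yes _ = refl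
... | no  _ = refl

countAlong : (ℤ → ℤ) → Buckets → ℤ → ℕ
countAlong g []             j = 0
countAlong g ((i , c) ∷ bs) j = point (g i) c j + countAlong g bs j

count≡countAlong-id : ∀ l bs j → count (sketch l bs) j ≡ countAlong id bs j
count≡countAlong-id l []             j = refl
count≡countAlong-id l ((i , c) ∷ bs) j with j ℤ.≟ i
... | yes _ = cong (c +_) (count≡countAlong-id l bs j)
... | no  _ = count≡countAlong-id l bs j

addTo-countAlong : ∀ g i c bs j →
  countAlong g (addTo i c bs) j ≡ point (g i) c j + countAlong g bs j
addTo-countAlong g i c []             j = refl
addTo-countAlong g i c ((k , d) ∷ bs) j with i ℤ.≟ k
... | yes refl = begin
  point (g i) (d + c) j + countAlong g bs j
    ≡⟨ cong (_+ countAlong g bs j) (point-+ (g i) d c j) ⟩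
  point (g i) d j + point (g i) c j + countAlong g bs j
    ≡⟨ +-assoc (point (g i) d j) (point (g i) c j) (countAlong g bs j) ⟩
  point (g i) d j + (point (g i) c j + countAlong g bs j)
    ≡⟨ x∙yz≈y∙xz (point (g i) d j) (point (g i) c j) (countAlong g bs j) ⟩
  point (g i) c j + (point (g i) d j + countAlong g bs j) ∎
  where open ≡-Reasoning
... | no _ = ≡-trans (cong (point (g k) d j +_) (addTo-countAlong g i c bs j))
                     (x∙yz≈y∙xz (point (g k) d j) (point (g i) c j) (countAlong g bs j))

addTo-length : ∀ i c bs → length bs ≤ length (addTo i c bs)
addTo-length i c []             = z≤n
addTo-length i c ((j , d) ∷ bs) with i ℤ.≟ j
... | yes _ = ≤-refl
... | no  _ = s≤s (addTo-length i c bs)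

collapse-countAlong : ∀ g l bs j →
  countAlong g (buckets (collapse (sketch l bs))) j ≡ countAlong (g ∘ ceilHalf) bs j
collapse-countAlong g l []             j = refl
collapse-countAlong g l ((i , c) ∷ bs) j =
  ≡-trans (addTo-countAlong g (ceilHalf i) c (buckets (collapse (sketch l bs))) j)
          (cong (point (g (ceilHalf i)) c j +_) (collapse-countAlong g l bs j))

addAll : Buckets → Buckets → Buckets
addAll bs₁ bs₂ = foldr (λ { (i , c) acc → addTo i c acc }) bs₁ bs₂

addAll-countAlong : ∀ g bs₁ bs₂ j →
  countAlong g (addAll bs₁ bs₂) j ≡ countAlong g bs₂ j + countAlong g bs₁ j
addAll-countAlong g bs₁ []              j = refl
addAll-countAlong g bs₁ ((i , c) ∷ bs₂) j =
  ≡-trans (addTo-countAlong g i c (addAll bs₁ bs₂) j)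
  (≡-trans (cong (point (g i) c j +_) (addAll-countAlong g bs₁ bs₂ j))
           (sym (+-assoc (point (g i) c j) (countAlong g bs₂ j) (countAlong g bs₁ j))))

level-collapseN : ∀ n S → level (collapseN n S) ≡ n + level S
level-collapseN zero    S = refl
level-collapseN (suc n) S = ≡-trans (level-collapseN n (collapse S)) (+-suc n (level S))

Fresh : ℤ → Buckets → Set
Fresh i = All (λ b → proj₁ b ≢ i)

data WellFormed : Buckets → Set where
  []  : WellFormed []
  _∷_ : ∀ {i c bs} → 0 < c × Fresh i bs → WellFormed bs → WellFormed ((i , c) ∷ bs)

addTo-fresh : ∀ {k i c bs} → i ≢ k → Fresh k bs → Fresh k (addTo i c bs)
addTo-fresh {bs = []} i≢k [] = i≢k ∷ []
addTo-fresh {i = i} {bs = (j , d) ∷ bs} i≢k (j≢k ∷ fr) with i ℤ.≟ j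
... | yes _ = j≢k ∷ fr
... | no  _ = j≢k ∷ addTo-fresh i≢k fr

addTo-wellFormed : ∀ {i c bs} → 0 < c → WellFormed bs → WellFormed (addTo i c bs)
addTo-wellFormed 0<c [] = (0<c , []) ∷ []
addTo-wellFormed {i} {c} {(j , d) ∷ bs} 0<c ((0<d , fr) ∷ wf) with i ℤ.≟ j
... | yes _   = (<-≤-trans 0<d (m≤m+n d c) , fr) ∷ wf
... | no  i≢j = (0<d , addTo-fresh i≢j fr) ∷ addTo-wellFormed 0<c wf

collapse-wellFormed : ∀ {l bs} → WellFormed bs → WellFormed (buckets (collapse (sketch l bs)))
collapse-wellFormed     []              = []
collapse-wellFormed {l} ((0<c , _) ∷ wf) = addTo-wellFormed 0<c (collapse-wellFormed {l} wf)

addAll-wellFormed : ∀ {bs₁ bs₂} → WellFormed bs₁ → WellFormed bs₂ → WellFormed (addAll bs₁ bs₂)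
addAll-wellFormed wf₁ []                = wf₁
addAll-wellFormed wf₁ ((0<c , _) ∷ wf₂) = addTo-wellFormed 0<c (addAll-wellFormed wf₁ wf₂)

removeKey : ℤ → Buckets → Buckets
removeKey i []             = []
removeKey i ((j , d) ∷ bs) with i ℤ.≟ j
... | yes _ = bs
... | no  _ = (j , d) ∷ removeKey i bs

removeKey-length : ∀ i bs → 0 < countAlong id bs i → length bs ≡ suc (length (removeKey i bs))
removeKey-length i ((j , d) ∷ bs) pos with i ℤ.≟ j
... | yes _ = refl
... | no  _ = cong suc (removeKey-length i bs pos)

fresh-countAlong : ∀ {i bs} → Fresh i bs → countAlong id bs i ≡ 0
fresh-countAlong [] = refl
fresh-countAlong {i} {(j , d) ∷ bs} (j≢i ∷ fr) with i ℤ.≟ j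
... | yes i≡j = ⊥-elim (j≢i (sym i≡j))
... | no  _   = fresh-countAlong fr

removeKey-fresh : ∀ {k i bs} → Fresh k bs → Fresh k (removeKey i bs)
removeKey-fresh [] = []
removeKey-fresh {i = i} {(j , d) ∷ bs} (j≢k ∷ fr) with i ℤ.≟ j
... | yes _ = fr
... | no  _ = j≢k ∷ removeKey-fresh fr

removeKey-wellFormed : ∀ {i bs} → WellFormed bs → WellFormed (removeKey i bs)
removeKey-wellFormed [] = []
removeKey-wellFormed {i} {(j , d) ∷ bs} ((0<d , fr) ∷ wf) with i ℤ.≟ j
... | yes _ = wf
... | no  _ = (0<d , removeKey-fresh fr) ∷ removeKey-wellFormed wf

countAlong-removeKey-≡ : ∀ {i bs} → WellFormed bs → countAlong id (removeKey i bs) i ≡ 0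
countAlong-removeKey-≡ [] = refl
countAlong-removeKey-≡ {i} {(j , d) ∷ bs} ((_ , fr) ∷ wf) with i ℤ.≟ j
... | yes refl = fresh-countAlong fr
... | no  i≢j  = ≡-trans (cong (_+ _) (point-≢ d i≢j)) (countAlong-removeKey-≡ wf)

countAlong-removeKey-≢ : ∀ i j bs → j ≢ i → countAlong id (removeKey i bs) j ≡ countAlong id bs j
countAlong-removeKey-≢ i j []             j≢i = refl
countAlong-removeKey-≢ i j ((k , d) ∷ bs) j≢i with i ℤ.≟ k
... | yes refl = sym (cong (_+ countAlong id bs j) (point-≢ d j≢i))
... | no  _    = cong (point k d j +_) (countAlong-removeKey-≢ i j bs j≢i)

head-countAlong-pos : ∀ {i c} bs → 0 < c → 0 < countAlong id ((i , c) ∷ bs) i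
head-countAlong-pos {i} {c} bs 0<c =
  <-≤-trans 0<c (≤-trans (m≤m+n c (countAlong id bs i)) (≤-reflexive (cong (_+ countAlong id bs i) (sym (point-≡ c refl)))))

wellFormed-length-unique : ∀ {bs bs'} → WellFormed bs → WellFormed bs' →
  (∀ j → countAlong id bs j ≡ countAlong id bs' j) → length bs ≡ length bs'
wellFormed-length-unique [] [] _ = refl
wellFormed-length-unique {bs' = (i , c) ∷ bs'} [] ((0<c , _) ∷ _) same =
  ⊥-elim (<-irrefl (same i) (head-countAlong-pos {i} bs' 0<c))
wellFormed-length-unique {(i , c) ∷ bs} {bs'} ((0<c , fr) ∷ wf) wf' same =
  ≡-trans (cong suc (wellFormed-length-unique wf (removeKey-wellFormed wf') same-rest))
          (sym (removeKey-length i bs' (subst (0 <_) (same i) (head-countAlong-pos {i} bs 0<c))))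
  where
  same-rest : ∀ j → countAlong id bs j ≡ countAlong id (removeKey i bs') j
  same-rest j with j ℤ.≟ i
  ... | yes refl = ≡-trans (fresh-countAlong fr) (sym (countAlong-removeKey-≡ wf'))
  ... | no  j≢i  = begin
    countAlong id bs j                 ≡⟨ cong (_+ countAlong id bs j) (point-≢ c j≢i) ⟨
    countAlong id ((i , c) ∷ bs) j     ≡⟨ same j ⟩
    countAlong id bs' j                ≡⟨ countAlong-removeKey-≢ i j bs' j≢i ⟨
    countAlong id (removeKey i bs') j  ∎
    where open ≡-Reasoning

tally : {X : Set} → (X → ℤ) → List X → ℤ → ℕ
tally h []      j = 0
tally h (x ∷ D) j = point (h x) 1 j + tally h D j

tally-cong : ∀ {X : Set} {h h' : X → ℤ} D j → (∀ x → h x ≡ h' x) → tally h D j ≡ tally h' D j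
tally-cong []      j h≗h' = refl
tally-cong (x ∷ D) j h≗h' = cong₂ _+_ (cong (λ a → point a 1 j) (h≗h' x)) (tally-cong D j h≗h')

tally-↭ : ∀ {X : Set} {h : X → ℤ} {D D'} j → D ↭ D' → tally h D j ≡ tally h D' j
tally-↭         j refl         = refl
tally-↭ {h = h} j (prep x p)   = cong (point (h x) 1 j +_) (tally-↭ j p)
tally-↭ {h = h} j (swap x y p) =
  ≡-trans (cong (λ t → point (h x) 1 j + (point (h y) 1 j + t)) (tally-↭ j p))
          (x∙yz≈y∙xz (point (h x) 1 j) (point (h y) 1 j) _)
tally-↭         j (trans p q)  = ≡-trans (tally-↭ j p) (tally-↭ j q)

tally-++ : ∀ {X : Set} (h : X → ℤ) D E j → tally h (D ++ E) j ≡ tally h D j + tally h E j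
tally-++ h []      E j = refl
tally-++ h (x ∷ D) E j = ≡-trans (cong (point (h x) 1 j +_) (tally-++ h D E j))
                                 (sym (+-assoc (point (h x) 1 j) (tally h D j) (tally h E j)))

module Histograms {X : Set} (key : ℕ → X → ℤ)
                  (key-suc : ∀ k x → key (suc k) x ≡ ceilHalf (key k x)) where

  -- Counts are compared after every relabelling g of the keys, so that a
  -- collapse (relabelling by ceilHalf) preserves the relation.
  record Represents (k : ℕ) (bs : Buckets) (D : List X) : Set where
    field
      wellFormed : WellFormed bs
      counts     : ∀ g j → countAlong g bs j ≡ tally (g ∘ key k) D j
  open Represents

  Models : Sketch → List X → Set
  Models S = Represents (level S) (buckets S)

  represents-↭ : ∀ {k bs D D'} → D ↭ D' → Represents k bs D → Represents k bs D'
  represents-↭ D↭D' r = record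
    { wellFormed = wellFormed r
    ; counts     = λ g j → ≡-trans (counts r g j) (tally-↭ j D↭D') }

  models-collapse : ∀ {S D} → Models S D → Models (collapse S) D
  models-collapse {S} {D} r = record
    { wellFormed = collapse-wellFormed {level S} (wellFormed r)
    ; counts     = λ g j → begin
        countAlong g (buckets (collapse S)) j       ≡⟨ collapse-countAlong g (level S) (buckets S) j ⟩
        countAlong (g ∘ ceilHalf) (buckets S) j     ≡⟨ counts r (g ∘ ceilHalf) j ⟩
        tally (g ∘ ceilHalf ∘ key (level S)) D j    ≡⟨ tally-cong D j (cong g ∘ sym ∘ key-suc (level S)) ⟩
        tally (g ∘ key (suc (level S))) D j         ∎ }
    where open ≡-Reasoning

  models-collapseN : ∀ n {S D} → Models S D → Models (collapseN n S) D
  models-collapseN zero    r = r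
  models-collapseN (suc n) r = models-collapseN n (models-collapse r)

  represents-raise : ∀ {k S D} → level S ≤ k → Models S D →
                     Represents k (buckets (collapseN (k ∸ level S) S)) D
  represents-raise {k} {S} {D} l≤k r =
    subst (λ l → Represents l (buckets (collapseN (k ∸ level S) S)) D)
          (≡-trans (level-collapseN (k ∸ level S) S) (m∸n+n≡m l≤k))
          (models-collapseN (k ∸ level S) r)

  represents-addAll : ∀ {k bs₁ bs₂ D₁ D₂} → Represents k bs₁ D₁ → Represents k bs₂ D₂ →
                      Represents k (addAll bs₁ bs₂) (D₂ ++ D₁)
  represents-addAll {k} {bs₁} {bs₂} {D₁} {D₂} r₁ r₂ = record
    { wellFormed = addAll-wellFormed (wellFormed r₁) (wellFormed r₂)
    ; counts     = λ g j → begin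
        countAlong g (addAll bs₁ bs₂) j                   ≡⟨ addAll-countAlong g bs₁ bs₂ j ⟩
        countAlong g bs₂ j + countAlong g bs₁ j           ≡⟨ cong₂ _+_ (counts r₂ g j) (counts r₁ g j) ⟩
        tally (g ∘ key k) D₂ j + tally (g ∘ key k) D₁ j   ≡⟨ tally-++ (g ∘ key k) D₂ D₁ j ⟨
        tally (g ∘ key k) (D₂ ++ D₁) j                    ∎ }
    where open ≡-Reasoning

  models-combine : ∀ {S₁ S₂ D₁ D₂} → Models S₁ D₁ → Models S₂ D₂ → Models (combine S₁ S₂) (D₁ ++ D₂)
  models-combine {S₁} {S₂} {D₁} {D₂} r₁ r₂ =
    represents-↭ (↭.++-comm D₂ D₁)
      (represents-addAll (represents-raise (m≤m⊔n (level S₁) (level S₂)) r₁)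
                         (represents-raise (m≤n⊔m (level S₁) (level S₂)) r₂))

  insertAll : ℕ → List X → Buckets → Buckets
  insertAll k E bs = foldr (λ x → addTo (key k x) 1) bs E

  represents-insertAll : ∀ {k bs D} E → Represents k bs D → Represents k (insertAll k E bs) (E ++ D)
  represents-insertAll []                    r = r
  represents-insertAll {k} {bs} {D} (x ∷ E) r = record
    { wellFormed = addTo-wellFormed (s≤s z≤n) (wellFormed r')
    ; counts     = λ g j → ≡-trans (addTo-countAlong g (key k x) 1 (insertAll k E bs) j)
                                   (cong (point (g (key k x)) 1 j +_) (counts r' g j)) }
    where r' = represents-insertAll E r

  insertAll-length : ∀ k E bs → length bs ≤ length (insertAll k E bs)
  insertAll-length k []      bs = ≤-refl
  insertAll-length k (x ∷ E) bs = ≤-trans (insertAll-length k E bs) (addTo-length (key k x) 1 (insertAll k E bs))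

  histogram : ℕ → List X → Buckets
  histogram k D = insertAll k D []

  width : ℕ → List X → ℕ
  width k D = length (histogram k D)

  represents-histogram : ∀ k D → Represents k (histogram k D) D
  represents-histogram k D =
    represents-↭ (↭.++-identityʳ D)
      (represents-insertAll D (record { wellFormed = [] ; counts = λ _ _ → refl }))

  represents-length : ∀ {k bs D} → Represents k bs D → length bs ≡ width k D
  represents-length {k} {bs} {D} r =
    wellFormed-length-unique (wellFormed r) (wellFormed h)
      (λ j → ≡-trans (counts r id j) (sym (counts h id j)))
    where h = represents-histogram k D

  width-↭ : ∀ {k D D'} → D ↭ D' → width k D ≡ width k D'
  width-↭ {k} {D} D↭D' = represents-length (represents-↭ D↭D' (represents-histogram k D))

  width-++ : ∀ {k} E D → width k D ≤ width k (E ++ D)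
  width-++ {k} E D =
    ≤-trans (insertAll-length k E (histogram k D))
            (≤-reflexive (represents-length (represents-insertAll E (represents-histogram k D))))

  module Canonicity (m : ℕ) where

    record Overflows (k : ℕ) (D : List X) : Set where
      constructor overflowing
      field below : ∀ {j} → j < k → m < width j D
    open Overflows

    overflows-↭ : ∀ {k D D'} → D ↭ D' → Overflows k D → Overflows k D'
    overflows-↭ D↭D' ov = overflowing λ {j} j<k → subst (m <_) (width-↭ {j} D↭D') (below ov j<k)

    overflows-++ : ∀ {k D} E → Overflows k D → Overflows k (E ++ D)
    overflows-++ {D = D} E ov = overflowing λ {j} j<k → <-≤-trans (below ov j<k) (width-++ {j} E D)

    overflows-suc : ∀ {k D} → Overflows k D → m < width k D → Overflows (suc k) D
    overflows-suc {k} {D} ov m<w = overflowing below′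
      where
      below′ : ∀ {j} → j < suc k → m < width j D
      below′ j<1+k with m<1+n⇒m<n∨m≡n j<1+k
      ... | inj₁ j<k  = below ov j<k
      ... | inj₂ refl = m<w

    overflows-⊔ : ∀ {k l D} → Overflows k D → Overflows l D → Overflows (k ⊔ l) D
    overflows-⊔ {k} {l} {D} ovₖ ovₗ = overflowing below′
      where
      below′ : ∀ {j} → j < k ⊔ l → m < width j D
      below′ j<k⊔l with ⊔-sel k l
      ... | inj₁ k⊔l≡k = below ovₖ (subst (_ <_) k⊔l≡k j<k⊔l)
      ... | inj₂ k⊔l≡l = below ovₗ (subst (_ <_) k⊔l≡l j<k⊔l)

    record Canonical (S : Sketch) (D : List X) : Set where
      field
        models    : Models S D
        fits      : size S ≤ m
        overflows : Overflows (level S) D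
    open Canonical

    canonical-↭ : ∀ {S D D'} → D ↭ D' → Canonical S D → Canonical S D'
    canonical-↭ D↭D' c = record
      { models    = represents-↭ D↭D' (models c)
      ; fits      = fits c
      ; overflows = overflows-↭ D↭D' (overflows c) }

    canonical-empty : Canonical emptySketch []
    canonical-empty = record
      { models    = record { wellFormed = [] ; counts = λ _ _ → refl }
      ; fits      = z≤n
      ; overflows = overflowing λ () }

    normalize-canonical : ∀ {S S' D} → Normalize m S S' → Models S D → Overflows (level S) D →
                          Canonical S' D
    normalize-canonical (done fits) r ov = record { models = r ; fits = fits ; overflows = ov }
    normalize-canonical (step m<size n) r ov =
      normalize-canonical n (models-collapse r)
        (overflows-suc ov (subst (m <_) (represents-length r) m<size))

    process-canonical : ∀ {S S' xs D} → Process key m S xs S' → Canonical S D → Canonical S' (xs ++ D)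
    process-canonical pnil c = c
    process-canonical {xs = x ∷ xs} {D} (pcons n p) c =
      canonical-↭ (↭.shift x xs D)
        (process-canonical p
          (normalize-canonical n (represents-insertAll (x ∷ []) (models c))
                                 (overflows-++ (x ∷ []) (overflows c))))

    produced-canonical : ∀ {xs S} → Produced key m xs S → Canonical S xs
    produced-canonical {xs} p = canonical-↭ (↭.++-identityʳ xs) (process-canonical p canonical-empty)

    merge-canonical : ∀ {S₁ S₂ S D₁ D₂} → Canonical S₁ D₁ → Canonical S₂ D₂ → Merge m S₁ S₂ S →
                      Canonical S (D₁ ++ D₂)
    merge-canonical {D₁ = D₁} {D₂} c₁ c₂ mg =
      normalize-canonical mg (models-combine (models c₁) (models c₂))
        (overflows-⊔ (overflows-↭ (↭.++-comm D₂ D₁) (overflows-++ D₂ (overflows c₁)))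
                     (overflows-++ D₁ (overflows c₂)))

    canonical-level-≮ : ∀ {S T D} → Canonical S D → Canonical T D → ¬ level S < level T
    canonical-level-≮ cS cT lS<lT =
      <⇒≱ (below (overflows cT) lS<lT) (subst (_≤ m) (represents-length (models cS)) (fits cS))

    canonical-unique : ∀ {S T D} → Canonical S D → Canonical T D → SketchEq S T
    canonical-unique {S} {T} {D} cS cT = levels , λ i → begin
      count S i                       ≡⟨ count≡countAlong-id (level S) (buckets S) i ⟩
      countAlong id (buckets S) i     ≡⟨ Represents.counts (models cS) id i ⟩
      tally (key (level S)) D i       ≡⟨ cong (λ l → tally (key l) D i) levels ⟩
      tally (key (level T)) D i       ≡⟨ Represents.counts (models cT) id i ⟨
      countAlong id (buckets T) i     ≡⟨ count≡countAlong-id (level T) (buckets T) i ⟨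
      count T i                       ∎
      where
      open ≡-Reasoning
      levels : level S ≡ level T
      levels = ≤-antisym (≮⇒≥ (canonical-level-≮ cT cS)) (≮⇒≥ (canonical-level-≮ cS cT))

theorem1 : {X : Set} (key : ℕ → X → ℤ) →
    (∀ k x → key (suc k) x ≡ ceilHalf (key k x)) →
    (m : ℕ) → 1 ≤ m →
    (xs₁ xs₂ xs : List X) → xs ↭ (xs₁ ++ xs₂) →
    (S₁ S₂ Sm Sg : Sketch) →
    Produced key m xs₁ S₁ → Produced key m xs₂ S₂ →
    Merge m S₁ S₂ Sm → Produced key m xs Sg →
    SketchEq Sg Sm
theorem1 key key-suc m _ xs₁ xs₂ xs xs↭ S₁ S₂ Sm Sg p₁ p₂ merged pg =
  canonical-unique (canonical-↭ xs↭ (produced-canonical pg))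
                   (merge-canonical (produced-canonical p₁) (produced-canonical p₂) merged)
  where
  open Histograms key key-suc
  open Canonicity m
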